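{- Let $\mapsto_\gamma$ be a root relation on $\Lambda$ that is substitutive. Then $\to_{\neg\mathsf h\gamma}\cdot\to_{\mathsf h\beta}\subseteq\to_{\mathsf h\beta}\cdot\to_\gamma^*$.
   Context: Terms $\Lambda$: $t::=x\mid c\mid\lambda x.t\mid tt$ modulo $\alpha$-equivalence ($c$ constants from a possibly empty set), with capture-avoiding substitution $t\{x:=q\}$. Contexts $C::=\langle\cdot\rangle\mid tC\mid Ct\mid\lambda x.C$; contextual closure $\to_\rho$ of $\mapsto_\rho$: $C\langle r\rangle\to_\rho C\langle r'\rangle$ for $r\mapsto_\rho r'$. $\beta$ rule: $(\lambda x.p)q\mapsto_\beta p\{x:=q\}$. Head contexts $H::=\lambda x_1\dots\lambda x_k.\langle\cdot\rangle t_1\dots t_n$ ($k,n\ge0$), non-head contexts the others; $\to_{\mathsf h\rho}$ / $\to_{\neg\mathsf h\rho}$ closure of $\mapsto_\rho$ under head / non-head contexts. $\mapsto$ is substitutive if $r\mapsto r'$ implies $r\{x:=q\}\mapsto r'\{x:=q\}$ for all $x,q$. $\to^*$ reflexive-transitive closure; $R\cdot S$ composition. -}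

module Defs where

open import Data.Nat using (ℕ; zero; suc; pred; _<?_; _≟_)
open import Data.Unit using (⊤)
open import Data.Product using (Σ; _×_)
open import Relation.Nullary using (¬_; yes; no)
open import Relation.Binary.PropositionalEquality using (_≡_)
open import Relation.Binary.Construct.Closure.ReflexiveTransitive using (Star)

-- λ-terms over a set of constants `Const` (possibly empty), with de Bruijn
-- indices, so that terms are identified up to α-equivalence.
data Term (Const : Set) : Set where
  var : ℕ → Term Const
  con : Const → Term Const
  lam : Term Const → Term Const
  app : Term Const → Term Const → Term Const

module _ {Const : Set} where

  shift : ℕ → Term Const → Term Const
  shift c (var i) with i <? c
  ... | yes _ = var i
  ... | no  _ = var (suc i)
  shift c (con k) = con k
  shift c (lam t) = lam (shift (suc c) t)
  shift c (app t u) = app (shift c t) (shift c u)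

  -- capture-avoiding substitution t{x:=q}: index x is replaced by q,
  -- free indices above x are decremented (x is bound away), q is shifted
  -- when going under binders.
  _[_:=_] : Term Const → ℕ → Term Const → Term Const
  var i [ x := q ] with i <? x
  ... | yes _ = var i
  ... | no  _ with i ≟ x
  ...   | yes _ = q
  ...   | no  _ = var (pred i)
  con k [ x := q ] = con k
  lam t [ x := q ] = lam (t [ suc x := shift 0 q ])
  app t u [ x := q ] = app (t [ x := q ]) (u [ x := q ])

  Rel : Set₁
  Rel = Term Const → Term Const → Set

  data β↦ : Rel where
    beta : ∀ p q → β↦ (app (lam p) q) (p [ 0 := q ])

  Substitutive : Rel → Set
  Substitutive R = ∀ {r r'} → R r r' → ∀ x q → R (r [ x := q ]) (r' [ x := q ])

  data Ctx : Set where
    hole : Ctx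
    appR : Term Const → Ctx → Ctx
    appL : Ctx → Term Const → Ctx
    lamC : Ctx → Ctx

  plug : Ctx → Term Const → Term Const
  plug hole r = r
  plug (appR t C) r = app t (plug C r)
  plug (appL C t) r = app (plug C r) t
  plug (lamC C) r = lam (plug C r)

  data IsSpine : Ctx → Set where
    hole : IsSpine hole
    appL : ∀ {C} t → IsSpine C → IsSpine (appL C t)

  data IsHead : Ctx → Set where
    spine : ∀ {C} → IsSpine C → IsHead C
    lamC  : ∀ {C} → IsHead C → IsHead (lamC C)

  IsNonHead : Ctx → Set
  IsNonHead C = ¬ IsHead C

  data CtxClosure (P : Ctx → Set) (R : Rel) : Rel where
    step : ∀ {C r r'} → P C → R r r' → CtxClosure P R (plug C r) (plug C r')

  ctx→ : Rel → Rel
  ctx→ = CtxClosure (λ _ → ⊤)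

  head→ : Rel → Rel
  head→ = CtxClosure IsHead

  nonhead→ : Rel → Rel
  nonhead→ = CtxClosure IsNonHead

  _·_ : Rel → Rel → Rel
  (R · S) t u = Σ (Term Const) λ s → R t s × S s u

  _⊆_ : Rel → Rel → Set
  R ⊆ S = ∀ {t u} → R t u → S t u

module Submission where

-- Let C⟨r⟩ →¬hγ C⟨r'⟩ = H⟨(λp)q⟩ →hβ H⟨p{0:=q}⟩.  Since C is not a head
-- context, walking down H (its λs, then its spine of applications) the
-- γ-redex either lies in one of the spine arguments, where it is disjoint
-- from the β-redex and the two steps simply swap, or it lies inside the
-- body p or the argument q of the β-redex itself.  In the body, the
-- γ-step survives the substitution as one step because →γ is substitutive;
-- in the argument, it is duplicated (or erased) by the substitution, giving
-- p{0:=q} →γ* p{0:=q'}.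
--
-- That last fact needs →γ to be closed under the de Bruijn shifts applied
-- to q when the substitution passes under binders.  Substitutivity only
-- speaks about substitution, so the file first shows that shifting a term
-- agrees with iterating the substitution of one variable for another (a
-- cyclic rotation of the free indices), on all terms whose free indices
-- are bounded.

open import Defs
open import Data.Nat using (ℕ; zero; suc; pred; _+_; _<_; _≤_; _⊔_; _<?_; _≟_; z≤n; s≤s)
open import Data.Nat.Properties
open import Data.Nat.GeneralisedArithmetic using (iterate)
open import Data.Empty using (⊥-elim)
open import Data.Product using (Σ; _×_; _,_)
open import Data.Unit using (tt)
open import Relation.Nullary using (¬_; yes; no)
open import Relation.Binary.PropositionalEquality
open import Relation.Binary.Construct.Closure.ReflexiveTransitive using (Star; ε; _◅_; _◅◅_; gmap)

iterate-+ : ∀ {A : Set} (f : A → A) x m n →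
            iterate f x (m + n) ≡ iterate f (iterate f x m) n
iterate-+ f x zero    n = refl
iterate-+ f x (suc m) n = iterate-+ f (f x) m n

iterate-commute : ∀ {A B : Set} (f : B → B) (g : A → A) (h : A → B) →
                  (∀ x → f (h x) ≡ h (g x)) →
                  ∀ x n → iterate f (h x) n ≡ h (iterate g x n)
iterate-commute f g h fh≡hg x zero    = refl
iterate-commute f g h fh≡hg x (suc n) =
  trans (cong (λ y → iterate f y n) (fh≡hg x)) (iterate-commute f g h fh≡hg (g x) n)

iterate-preserves : ∀ {A : Set} {R : A → A → Set} (f : A → A) →
                    (∀ {a b} → R a b → R (f a) (f b)) →
                    ∀ {a b} n → R a b → R (iterate f a n) (iterate f b n)
iterate-preserves f pres zero    r = r
iterate-preserves {R = R} f pres (suc n) r = iterate-preserves {R = R} f pres n (pres r)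

subst-index : ℕ → ℕ → ℕ → ℕ
subst-index c k i with i <? c
... | yes _ = i
... | no  _ with i ≟ c
...   | yes _ = k
...   | no  _ = pred i

-- For k = c + n, subst-index c k cyclically rotates the block c, c+1, …, c+n one
-- place down, so n rotations move every index of the block but the last
-- one place up: on indices < c + n they act as the shift at cutoff c.
module Rotation (c n : ℕ) where

  σ : ℕ → ℕ
  σ = subst-index c (c + n)

  σ-below : ∀ {i} → i < c → σ i ≡ i
  σ-below {i} i<c with i <? c
  ... | yes _   = refl
  ... | no  i≮c = ⊥-elim (i≮c i<c)

  σ-base : σ c ≡ c + n
  σ-base with c <? c
  ... | yes c<c = ⊥-elim (n≮n c c<c)
  ... | no  _ with c ≟ c
  ...   | yes _   = refl
  ...   | no  c≢c = ⊥-elim (c≢c refl)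

  σ-above : ∀ b → σ (c + suc b) ≡ c + b
  σ-above b with c + suc b <? c
  ... | yes lt = ⊥-elim (m+n≮m c (suc b) lt)
  ... | no  _ with c + suc b ≟ c
  ...   | yes eq = ⊥-elim (m+1+n≢m c eq)
  ...   | no  _  = cong pred (+-suc c b)

  iterate-below : ∀ {i} j → i < c → iterate σ i j ≡ i
  iterate-below zero    i<c = refl
  iterate-below (suc j) i<c = trans (cong (λ y → iterate σ y j) (σ-below i<c)) (iterate-below j i<c)

  iterate-down : ∀ j b → iterate σ (c + (j + b)) j ≡ c + b
  iterate-down zero    b = refl
  iterate-down (suc j) b = trans (cong (λ y → iterate σ y j) (σ-above (j + b))) (iterate-down j b)

  -- n rotations move c + a up to c + a + 1, as long as a < n: a steps
  -- bring it down to c, one more to c + n, and the rest down to c + a + 1.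
  iterate-up : ∀ {a} → a < n → iterate σ (c + a) n ≡ c + suc a
  iterate-up {a} a<n with m≤n⇒∃[o]m+o≡n a<n
  ... | o , 1+a+o≡n = begin
    iterate σ (c + a) n                   ≡⟨ cong (iterate σ (c + a)) n≡a+1+o ⟩
    iterate σ (c + a) (a + suc o)         ≡⟨ iterate-+ σ (c + a) a (suc o) ⟩
    iterate σ (iterate σ (c + a) a) (suc o) ≡⟨ cong (λ y → iterate σ y (suc o)) to-base ⟩
    iterate σ (σ c) o                     ≡⟨ cong (λ y → iterate σ y o) σ-base ⟩
    iterate σ (c + n) o                   ≡⟨ cong (λ m → iterate σ (c + m) o) n≡o+1+a ⟩
    iterate σ (c + (o + suc a)) o         ≡⟨ iterate-down o (suc a) ⟩
    c + suc a                             ∎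
    where
    open ≡-Reasoning
    n≡a+1+o : n ≡ a + suc o
    n≡a+1+o = trans (sym 1+a+o≡n) (sym (+-suc a o))
    n≡o+1+a : n ≡ o + suc a
    n≡o+1+a = trans (sym 1+a+o≡n) (+-comm (suc a) o)
    to-base : iterate σ (c + a) a ≡ c
    to-base = begin
      iterate σ (c + a) a       ≡⟨ cong (λ m → iterate σ (c + m) a) (sym (+-identityʳ a)) ⟩
      iterate σ (c + (a + 0)) a ≡⟨ iterate-down a 0 ⟩
      c + 0                     ≡⟨ +-identityʳ c ⟩
      c                         ∎

module _ {Const : Set} where

  private
    T = Term Const

  fvBound : T → ℕ
  fvBound (var i)   = suc i
  fvBound (con k)   = 0
  fvBound (lam t)   = pred (fvBound t)
  fvBound (app t u) = fvBound t ⊔ fvBound u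

  sub-var : ∀ c k i → var {Const} i [ c := var k ] ≡ var (subst-index c k i)
  sub-var c k i with i <? c
  ... | yes _ = refl
  ... | no  _ with i ≟ c
  ...   | yes _ = refl
  ...   | no  _ = refl

  iterate-sub-app : ∀ c (q t u : T) n →
                    iterate (_[ c := q ]) (app t u) n ≡
                    app (iterate (_[ c := q ]) t n) (iterate (_[ c := q ]) u n)
  iterate-sub-app c q t u zero    = refl
  iterate-sub-app c q t u (suc n) = iterate-sub-app c q (t [ c := q ]) (u [ c := q ]) n

  shift-as-substitutions : ∀ c n (t : T) → fvBound t ≤ c + n →
                           iterate (_[ c := var (c + n) ]) t n ≡ shift c t
  shift-as-substitutions c n (var i) i<c+n with i <? c
  ... | yes i<c = trans (iterate-commute _ (subst-index c (c + n)) var (sub-var c (c + n)) i n)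
                        (cong var (Rotation.iterate-below c n n i<c))
  ... | no  i≮c with m≤n⇒∃[o]m+o≡n (≮⇒≥ i≮c)
  ...   | a , refl = trans (iterate-commute _ (subst-index c (c + n)) var (sub-var c (c + n)) (c + a) n)
                           (cong var (trans (Rotation.iterate-up c n (+-cancelˡ-< c a n i<c+n))
                                            (+-suc c a)))
  shift-as-substitutions c n (con k) _ =
    iterate-commute _ (λ u → u) (λ _ → con k) (λ _ → refl) (con k) n
  shift-as-substitutions c n (lam t) bound =
    trans (iterate-commute _ _ lam (λ _ → refl) t n)
          (cong lam (shift-as-substitutions (suc c) n t (pred≤⇒≤suc (fvBound t) bound)))
    where
    pred≤⇒≤suc : ∀ m {k} → pred m ≤ k → m ≤ suc k
    pred≤⇒≤suc zero    _  = z≤n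
    pred≤⇒≤suc (suc m) le = s≤s le
  shift-as-substitutions c n (app t u) bound =
    trans (iterate-sub-app c (var (c + n)) t u n)
          (cong₂ app (shift-as-substitutions c n t (m⊔n≤o⇒m≤o (fvBound t) (fvBound u) bound))
                     (shift-as-substitutions c n u (m⊔n≤o⇒n≤o (fvBound t) (fvBound u) bound)))

  ShiftClosed : Rel {Const} → Set
  ShiftClosed R = ∀ c {r r'} → R r r' → R (shift c r) (shift c r')

  -- A substitutive relation is closed under shifting: choose n so large
  -- that both r and r' have their free indices below c + n.
  substitutive⇒shiftClosed : ∀ {R} → Substitutive R → ShiftClosed R
  substitutive⇒shiftClosed {R} sub c {r} {r'} rRr' =
    subst₂ R (shift-as-substitutions c n r (bounded (m≤m⊔n (fvBound r) (fvBound r'))))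
             (shift-as-substitutions c n r' (bounded (m≤n⊔m (fvBound r) (fvBound r'))))
             (iterate-preserves {R = R} (_[ c := var (c + n) ]) (λ s → sub s c (var (c + n))) n rRr')
    where
    n = fvBound r ⊔ fvBound r'
    bounded : ∀ {m} → m ≤ n → m ≤ c + n
    bounded m≤n = ≤-trans m≤n (m≤n+m n c)

  module _ {R : Rel {Const}} where

    ctx-appL : ∀ t {a b} → ctx→ R a b → ctx→ R (app a t) (app b t)
    ctx-appL t (step {C} _ s) = step {C = appL C t} tt s

    ctx-appR : ∀ t {a b} → ctx→ R a b → ctx→ R (app t a) (app t b)
    ctx-appR t (step {C} _ s) = step {C = appR t C} tt s

    ctx-lam : ∀ {a b} → ctx→ R a b → ctx→ R (lam a) (lam b)
    ctx-lam (step {C} _ s) = step {C = lamC C} tt s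

    -- Shifting and substitution commute with plugging into a context (up
    -- to moving under the context's binders), hence the contextual closure
    -- inherits closure under both operations.
    ctx-shiftClosed : ShiftClosed R → ShiftClosed (ctx→ R)
    ctx-shiftClosed shR c (step {C} _ s) = go C c
      where
      go : ∀ D c → ctx→ R (shift c (plug D _)) (shift c (plug D _))
      go hole       c = step {C = hole} tt (shR c s)
      go (appR t D) c = ctx-appR (shift c t) (go D c)
      go (appL D t) c = ctx-appL (shift c t) (go D c)
      go (lamC D)   c = ctx-lam (go D (suc c))

    ctx-substitutive : Substitutive R → Substitutive (ctx→ R)
    ctx-substitutive subR (step {C} _ s) = go C
      where
      go : ∀ D x q → ctx→ R (plug D _ [ x := q ]) (plug D _ [ x := q ])
      go hole       x q = step {C = hole} tt (subR s x q)
      go (appR t D) x q = ctx-appR (t [ x := q ]) (go D x q)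
      go (appL D t) x q = ctx-appL (t [ x := q ]) (go D x q)
      go (lamC D)   x q = ctx-lam (go D (suc x) (shift 0 q))

    -- A step in the substituted term becomes one step per occurrence of
    -- the variable.
    substitute-step : ShiftClosed R → ∀ p x {q q'} → ctx→ R q q' →
                      Star (ctx→ R) (p [ x := q ]) (p [ x := q' ])
    substitute-step shR (var i) x s with i <? x
    ... | yes _ = ε
    ... | no  _ with i ≟ x
    ...   | yes _ = s ◅ ε
    ...   | no  _ = ε
    substitute-step shR (con k) x s = ε
    substitute-step shR (lam p) x s =
      gmap lam ctx-lam (substitute-step shR p (suc x) (ctx-shiftClosed shR 0 s))
    substitute-step shR (app p₁ p₂) x {q} {q'} s =
      gmap (λ a → app a (p₂ [ x := q ])) (ctx-appL _) (substitute-step shR p₁ x s) ◅◅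
      gmap (app (p₁ [ x := q' ])) (ctx-appR _) (substitute-step shR p₂ x s)

head-inversion : ∀ {Const} {a b : Term Const} → head→ β↦ a b →
                 Σ Ctx λ H → Σ (Term Const) λ p → Σ (Term Const) λ q →
                 IsHead H × a ≡ plug H (app (lam p) q) × b ≡ plug H (p [ 0 := q ])
head-inversion (step {H} h (beta p q)) = H , p , q , h , refl , refl

module Postponement {Const : Set} (γ : Rel {Const}) (sub : Substitutive γ) where

  private
    T = Term Const

  spine→β : Rel {Const}
  spine→β = CtxClosure IsSpine β↦

  _then-γ* : Rel {Const} → Rel {Const}
  B then-γ* = B · Star (ctx→ γ)

  spine-appL : ∀ t {a b : T} → spine→β a b → spine→β (app a t) (app b t)
  spine-appL t (step {C} sp b) = step {C = appL C t} (appL t sp) b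

  spine⇒head : ∀ {a b : T} → spine→β a b → head→ β↦ a b
  spine⇒head (step sp b) = step (spine sp) b

  head-lam : ∀ {a b : T} → head→ β↦ a b → head→ β↦ (lam a) (lam b)
  head-lam (step {C} h b) = step {C = lamC C} (lamC h) b

  app-injective : ∀ {a b c d : T} → app a b ≡ app c d → a ≡ c × b ≡ d
  app-injective refl = refl , refl

  lam-injective : ∀ {a c : T} → lam a ≡ lam c → a ≡ c
  lam-injective refl = refl

  -- Root case: a γ-step that is not on the spine and produces a β-redex
  -- sits inside the redex's argument or body.
  redex-case : ∀ {C r r' p q} → ¬ IsSpine C → γ r r' →
               plug C r' ≡ app (lam p) q → (β↦ then-γ*) (plug C r) (p [ 0 := q ])
  redex-case {C = hole} notSpine _ _ = ⊥-elim (notSpine hole)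
  redex-case {C = appR _ C'} {r} {p = p} _ s refl =
    p [ 0 := plug C' r ] , beta p (plug C' r) ,
    substitute-step (substitutive⇒shiftClosed sub) p 0 (step {C = C'} tt s)
  redex-case {C = appL hole t} notSpine _ _ = ⊥-elim (notSpine (appL t hole))
  redex-case {C = appL (lamC C') t} {r} _ s refl =
    plug C' r [ 0 := t ] , beta (plug C' r) t ,
    ctx-substitutive sub (step {C = C'} tt s) 0 t ◅ ε
  redex-case {C = appL (appR _ _) _} _ _ ()
  redex-case {C = appL (appL _ _) _} _ _ ()
  redex-case {C = lamC _} _ _ ()

  -- Spine case: below the spine either the γ-step is in a spine argument
  -- (disjoint from the redex, the steps swap) or we descend to the root.
  spine-case : ∀ {S C r r' p q} → IsSpine S → ¬ IsSpine C → γ r r' →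
               plug C r' ≡ plug S (app (lam p) q) →
               (spine→β then-γ*) (plug C r) (plug S (p [ 0 := q ]))
  spine-case hole notSpine s e with redex-case notSpine s e
  ... | w , b , ss = w , step hole b , ss
  spine-case {C = hole} (appL _ _) notSpine _ _ = ⊥-elim (notSpine hole)
  spine-case {C = lamC _} (appL _ _) _ _ ()
  spine-case {S = appL S' _} {C = appR _ C'} {r} {p = p} {q} (appL t sp) _ s refl =
    app (plug S' (p [ 0 := q ])) (plug C' r) , step (appL (plug C' r) sp) (beta p q) ,
    ctx-appR _ (step {C = C'} tt s) ◅ ε
  spine-case {C = appL C' _} (appL t sp) notSpine s e with app-injective e
  ... | e' , refl with spine-case sp (λ sp' → notSpine (appL t sp')) s e'
  ...   | w , b , ss = app w t , spine-appL t b , gmap (λ a → app a t) (ctx-appL t) ss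

  head-case : ∀ {H C r r' p q} → IsHead H → ¬ IsHead C → γ r r' →
              plug C r' ≡ plug H (app (lam p) q) →
              (head→ β↦ then-γ*) (plug C r) (plug H (p [ 0 := q ]))
  head-case (spine sp) notHead s e with spine-case sp (λ sp' → notHead (spine sp')) s e
  ... | w , b , ss = w , spine⇒head b , ss
  head-case {C = hole} (lamC _) notHead _ _ = ⊥-elim (notHead (spine hole))
  head-case {C = appR _ _} (lamC _) _ _ ()
  head-case {C = appL _ _} (lamC _) _ _ ()
  head-case {C = lamC C'} (lamC h) notHead s e
    with head-case h (λ h' → notHead (lamC h')) s (lam-injective e)
  ... | w , b , ss = lam w , head-lam b , gmap lam ctx-lam ss

lemma4p4 : {Const : Set} (γ : Rel {Const}) → Substitutive γ →
           (nonhead→ γ · head→ β↦) ⊆ (head→ β↦ · Star (ctx→ γ))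
lemma4p4 γ sub (_ , step notHead s , hβ) with head-inversion hβ
... | _ , _ , _ , h , e , refl = Postponement.head-case γ sub h notHead s e
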